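{- The set-function $\mathrm{Max}$ is $(\oplus,\otimes,\Downarrow)$-definable.
   Context: $\mathbb{N}=\{0,1,2,\ldots\}$, $2^{\mathbb{N}}$ is its power set. For a collection $\mathcal{O}$ of functions $(2^{\mathbb{N}})^k\to2^{\mathbb{N}}$, $\mathcal{O}$-circuits are terms built from variables ranging over $2^{\mathbb{N}}$, the constants $\emptyset$, $\mathbb{N}$, $\{n\}$ ($n\in\mathbb{N}$), the operations $\cup$, $\cap$, complement relative to $\mathbb{N}$, and the functions in $\mathcal{O}$; a function $(2^{\mathbb{N}})^n\to2^{\mathbb{N}}$ is $\mathcal{O}$-definable if some $\mathcal{O}$-circuit in $n$ variables evaluates to it. $(\oplus,\otimes,\Downarrow)$-definable means $\{\oplus,\otimes,\Downarrow\}$-definable, where $s\oplus t=\{m+n\mid m\in s,n\in t\}$, $s\otimes t=\{mn\mid m\in s,n\in t\}$, $\Downarrow(x)=\{m\in\mathbb{N}\mid\exists n\in x,\ m\le n\}$. $\mathrm{Max}(x)=\emptyset$ if $x=\emptyset$, $\mathbb{N}$ if $x$ is infinite, and $\{\max x\}$ otherwise. -}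

module Defs where

open import Data.Nat using (ℕ; _+_; _*_; _≤_)
open import Data.Fin using (Fin)
open import Data.List using (List)
open import Data.List.Membership.Propositional using (_∈_)
open import Data.Product using (Σ; ∃; _×_)
open import Data.Sum using (_⊎_)
open import Data.Empty using (⊥)
open import Data.Unit using (⊤)
open import Relation.Nullary using (¬_)
open import Relation.Binary.PropositionalEquality using (_≡_)
open import Function.Bundles using (_⇔_)

SetN : Set₁
SetN = ℕ → Set

∅ˢ : SetN
∅ˢ _ = ⊥

ℕˢ : SetN
ℕˢ _ = ⊤

｛_｝ : ℕ → SetN
｛ n ｝ m = m ≡ n

_∪ˢ_ : SetN → SetN → SetN
(s ∪ˢ t) m = s m ⊎ t m

_∩ˢ_ : SetN → SetN → SetN
(s ∩ˢ t) m = s m × t m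

∁ˢ : SetN → SetN
∁ˢ s m = ¬ s m

_⊕_ : SetN → SetN → SetN
(s ⊕ t) k = Σ ℕ λ m → Σ ℕ λ n → s m × t n × k ≡ m + n

_⊗_ : SetN → SetN → SetN
(s ⊗ t) k = Σ ℕ λ m → Σ ℕ λ n → s m × t n × k ≡ m * n

⇓ : SetN → SetN
⇓ x m = Σ ℕ λ n → x n × m ≤ n

data Circuit (n : ℕ) : Set where
  var    : Fin n → Circuit n
  emptyC : Circuit n
  natC   : Circuit n
  single : ℕ → Circuit n
  _∪C_   : Circuit n → Circuit n → Circuit n
  _∩C_   : Circuit n → Circuit n → Circuit n
  compC  : Circuit n → Circuit n
  _⊕C_   : Circuit n → Circuit n → Circuit n
  _⊗C_   : Circuit n → Circuit n → Circuit n
  ⇓C     : Circuit n → Circuit n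

⟦_⟧ : ∀ {n} → Circuit n → (Fin n → SetN) → SetN
⟦ var i ⟧ ρ = ρ i
⟦ emptyC ⟧ ρ = ∅ˢ
⟦ natC ⟧ ρ = ℕˢ
⟦ single k ⟧ ρ = ｛ k ｝
⟦ c ∪C d ⟧ ρ = ⟦ c ⟧ ρ ∪ˢ ⟦ d ⟧ ρ
⟦ c ∩C d ⟧ ρ = ⟦ c ⟧ ρ ∩ˢ ⟦ d ⟧ ρ
⟦ compC c ⟧ ρ = ∁ˢ (⟦ c ⟧ ρ)
⟦ c ⊕C d ⟧ ρ = ⟦ c ⟧ ρ ⊕ ⟦ d ⟧ ρ
⟦ c ⊗C d ⟧ ρ = ⟦ c ⟧ ρ ⊗ ⟦ d ⟧ ρ
⟦ ⇓C c ⟧ ρ = ⇓ (⟦ c ⟧ ρ)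

Definable : (n : ℕ) → ((Fin n → SetN) → SetN) → Set₁
Definable n f = Σ (Circuit n) λ c → ∀ (ρ : Fin n → SetN) (m : ℕ) → ⟦ c ⟧ ρ m ⇔ f ρ m

Finite : SetN → Set
Finite x = Σ (List ℕ) λ l → ∀ m → x m → m ∈ l

-- Max x = ∅ if x = ∅, ℕ if x infinite, {max x} otherwise.
-- m ∈ Max x  iff  x is infinite, or m ∈ x and m is the greatest element of x.
Max : SetN → SetN
Max x m = (¬ Finite x) ⊎ (x m × (∀ n → x n → n ≤ m))

module Submission where

-- Max is defined by the circuit   Unb(X) ∪ (X ∩ ∁ Below(X)),   where
--   * Below(x) = ⇓(⇓x ∩ Evens) ∩ ⇓(⇓x ∩ Odds) is the set of numbers lying
--     strictly below some element of x: m < n ∈ x puts both m and m+1 (one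
--     even, one odd) into ⇓x, and conversely an even e and an odd o in ⇓x with
--     m ≤ e, m ≤ o cannot both equal m;
--   * Unb(x) = ∁ ⇓(∁(⇓x) ⊕ ℕ) is ℕ when x is infinite and ∅ otherwise: ⇓x is
--     all of ℕ exactly when x is unbounded, and a nonempty set shifted by ℕ
--     is cofinal, so its downward closure is ℕ.
-- For finite x the elements of x not in Below(x) are exactly the greatest
-- elements, which gives Max.

open import Defs
open import Data.Fin using (zero)
open import Data.Nat using (ℕ; zero; suc; _+_; _*_; _≤_; _<_; s≤s; _<?_)
open import Data.Nat.Properties
  using (≤-refl; <⇒≤; <-≤-trans; <-irrefl; ≮⇒≥; ≰⇒>; m≤n⇒m<n∨m≡n;
         m≤n+m; n≤1+n; +-comm; +-suc; even≢odd)
open import Data.List using (upTo)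
open import Data.List.Extrema.Nat using (max; xs≤max)
open import Data.List.Membership.Propositional.Properties using (∈-upTo⁺)
import Data.List.Relation.Unary.All as All
open import Data.Product using (Σ; _×_; _,_)
open import Data.Sum using (_⊎_; inj₁; inj₂)
open import Data.Empty using (⊥; ⊥-elim)
open import Data.Unit using (tt)
open import Relation.Nullary using (¬_; yes; no)
open import Relation.Binary.PropositionalEquality using (refl; sym; trans; cong)
open import Function.Bundles using (Equivalence; _⇔_; mk⇔)

finite⇒bounded : ∀ {x} → Finite x → Σ ℕ λ b → ∀ n → x n → n < b
finite⇒bounded (l , cover) =
  suc (max 0 l) , λ n xn → s≤s (All.lookup (xs≤max 0 l) (cover n xn))

bounded⇒finite : ∀ {x} b → (∀ n → x n → n < b) → Finite x
bounded⇒finite b bound = upTo b , λ n xn → ∈-upTo⁺ (bound n xn)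

Unb : SetN → SetN
Unb x = ∁ˢ (⇓ (∁ˢ (⇓ x) ⊕ ℕˢ))

Unb⇔infinite : ∀ x m → Unb x m ⇔ (¬ Finite x)
Unb⇔infinite x m = mk⇔ to from
  where
  -- A bound b of a finite x lies outside ⇓x, so every m ≤ b + m lies in
  -- ⇓(∁(⇓x) ⊕ ℕ).
  to : Unb x m → ¬ Finite x
  to unb fin with finite⇒bounded fin
  ... | b , bound =
    unb (b + m , (b , m , b∉⇓x , tt , refl) , m≤n+m m b)
    where
    b∉⇓x : ¬ ⇓ x b
    b∉⇓x (n , xn , b≤n) = <-irrefl refl (<-≤-trans (bound n xn) b≤n)

  -- Any a outside ⇓x bounds x strictly.
  from : ¬ Finite x → Unb x m
  from infinite (_ , (a , _ , a∉⇓x , _ , _) , _) =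
    infinite (bounded⇒finite a λ n xn → ≰⇒> λ a≤n → a∉⇓x (n , xn , a≤n))

Evens : SetN
Evens = ｛ 2 ｝ ⊗ ℕˢ

Odds : SetN
Odds = Evens ⊕ ｛ 1 ｝

even : ∀ k → Evens (2 * k)
even k = 2 , k , refl , tt , refl

odd : ∀ k → Odds (suc (2 * k))
odd k = 2 * k , 1 , even k , refl , +-comm 1 (2 * k)

odd⇒suc-even : ∀ {o} → Odds o → Evens (suc o)
odd⇒suc-even (_ , _ , (_ , k , refl , tt , refl) , refl , refl) =
  2 , suc k , refl , tt , cong suc (trans (+-comm (2 * k) 1) (sym (+-suc k (k + 0))))

even⇒suc-odd : ∀ {e} → Evens e → Odds (suc e)
even⇒suc-odd (_ , k , refl , tt , refl) = odd k

consecutive-parity : ∀ m → (Evens m × Odds (suc m)) ⊎ (Odds m × Evens (suc m))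
consecutive-parity zero = inj₁ (even 0 , odd 0)
consecutive-parity (suc m) with consecutive-parity m
... | inj₁ (_ , m+1-odd)  = inj₂ (m+1-odd , odd⇒suc-even m+1-odd)
... | inj₂ (_ , m+1-even) = inj₁ (m+1-even , even⇒suc-odd m+1-even)

even∧odd-disjoint : ∀ {m} → Evens m → Odds m → ⊥
even∧odd-disjoint (_ , k , refl , tt , refl) (_ , _ , (_ , k′ , refl , tt , refl) , refl , eq) =
  even≢odd k k′ (trans eq (+-comm (2 * k′) 1))

StrictlyBelow : SetN → SetN
StrictlyBelow x m = Σ ℕ λ n → x n × m < n

Below : SetN → SetN
Below x = ⇓ (⇓ x ∩ˢ Evens) ∩ˢ ⇓ (⇓ x ∩ˢ Odds)

Below⇔StrictlyBelow : ∀ x m → Below x m ⇔ StrictlyBelow x m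
Below⇔StrictlyBelow x m = mk⇔ to from
  where
  -- m ≤ e and m ≤ o with e even, o odd: one inequality is strict.
  to : Below x m → StrictlyBelow x m
  to ((e , ((n , xn , e≤n) , e-even) , m≤e) , (o , ((n′ , xn′ , o≤n′) , o-odd) , m≤o))
    with m≤n⇒m<n∨m≡n m≤e | m≤n⇒m<n∨m≡n m≤o
  ... | inj₁ m<e | _        = n , xn , <-≤-trans m<e e≤n
  ... | inj₂ _   | inj₁ m<o = n′ , xn′ , <-≤-trans m<o o≤n′
  ... | inj₂ refl | inj₂ refl = ⊥-elim (even∧odd-disjoint e-even o-odd)

  -- m < n ∈ x puts m and m + 1, of different parities, into ⇓x.
  from : StrictlyBelow x m → Below x m
  from (n , xn , m<n) with consecutive-parity m
  ... | inj₁ (m-even , m+1-odd) =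
    (m , ((n , xn , <⇒≤ m<n) , m-even) , ≤-refl) ,
    (suc m , ((n , xn , m<n) , m+1-odd) , n≤1+n m)
  ... | inj₂ (m-odd , m+1-even) =
    (suc m , ((n , xn , m<n) , m+1-even) , n≤1+n m) ,
    (m , ((n , xn , <⇒≤ m<n) , m-odd) , ≤-refl)

MaxExpr : SetN → SetN
MaxExpr x = Unb x ∪ˢ (x ∩ˢ ∁ˢ (Below x))

Max⇔ : ∀ x m → MaxExpr x m ⇔ Max x m
Max⇔ x m = mk⇔ to from
  where
  module U = Equivalence (Unb⇔infinite x m)
  module B = Equivalence (Below⇔StrictlyBelow x m)

  to : MaxExpr x m → Max x m
  to (inj₁ unb) = inj₁ (U.to unb)
  to (inj₂ (xm , not-below)) = inj₂ (xm , greatest)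
    where
    greatest : ∀ n → x n → n ≤ m
    greatest n xn with m <? n
    ... | yes m<n = ⊥-elim (not-below (B.from (n , xn , m<n)))
    ... | no m≮n  = ≮⇒≥ m≮n

  from : Max x m → MaxExpr x m
  from (inj₁ infinite) = inj₁ (U.from infinite)
  from (inj₂ (xm , greatest)) = inj₂ (xm , not-below)
    where
    not-below : ∁ˢ (Below x) m
    not-below below with B.to below
    ... | n , xn , m<n = <-irrefl refl (<-≤-trans m<n (greatest n xn))

-- The circuits for Unb, Below and MaxExpr; ⟦_⟧ maps each of them
-- definitionally to the corresponding set expression.

evensC : ∀ {k} → Circuit k
evensC = single 2 ⊗C natC

oddsC : ∀ {k} → Circuit k
oddsC = evensC ⊕C single 1

unbC : ∀ {k} → Circuit k → Circuit k
unbC c = compC (⇓C (compC (⇓C c) ⊕C natC))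

belowC : ∀ {k} → Circuit k → Circuit k
belowC c = ⇓C (⇓C c ∩C evensC) ∩C ⇓C (⇓C c ∩C oddsC)

maxC : ∀ {k} → Circuit k → Circuit k
maxC c = unbC c ∪C (c ∩C compC (belowC c))

maxC-correct : ∀ {k} (c : Circuit k) ρ m → ⟦ maxC c ⟧ ρ m ⇔ Max (⟦ c ⟧ ρ) m
maxC-correct c ρ = Max⇔ (⟦ c ⟧ ρ)

theorem12 : Definable 1 (λ ρ → Max (ρ zero))
theorem12 = maxC (var zero) , maxC-correct (var zero)
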